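{- If $G$ is a singleton-partition graph of order $n$ with $\delta(G)=2$ that contains at least one full vertex, then $L_{\rm SCC}(G)=1$.
   Context: All graphs are finite and simple. A full vertex is a vertex adjacent to all other vertices. A set $D\subseteq V$ is dominating if every vertex not in $D$ has a neighbor in $D$. Two disjoint sets $A,B\subseteq V$ form a coalition if neither is dominating but $A\cup B$ is. A coalition partition of $G$ is a partition $\mathcal{P}$ of $V$ such that every member is either a dominating set of cardinality 1, or is not dominating and forms a coalition with some other member. The coalition graph ${\rm CG}(G,\mathcal{P})$ has vertex set $\mathcal{P}$, two members adjacent iff they form a coalition. $\Gamma_1$ is the partition of $V$ into singletons; $G$ is a singleton-partition graph (SP-graph) if $\Gamma_1$ is a coalition partition of $G$. A singleton coalition graph chain with initial graph $G_1$ is a sequence $G_1\to G_2\to\cdots$ where each graph having a successor is an SP-graph and its successor is ${\rm CG}(G_i,\Gamma_1)$ (up to isomorphism). The $G$-SC chain is such a chain starting at $G$ of maximum possible length (it continues as long as the current graph is an SP-graph). Its length $L_{\rm SCC}(G)$ is $k-1$ for a chain $G_1\to\cdots\to G_k$ and $\infty$ for an infinite chain, with the convention that if all graphs in the chain are isomorphic the length is $0$. -}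

module Defs where

open import Data.Nat using (ℕ; zero; suc; _≤_; _<_)
open import Data.Fin using (Fin; _≟_)
open import Data.Fin.Properties using (all?; any?)
open import Data.List using (length; filter; allFin)
open import Data.Product using (Σ; ∃; _×_; _,_)
open import Data.Sum using (_⊎_)
open import Data.Empty using (⊥)
open import Relation.Nullary using (¬_; Dec; yes; no)
open import Relation.Nullary.Decidable using (_×-dec_; _⊎-dec_; ¬?)
open import Relation.Binary.PropositionalEquality using (_≡_; _≢_; refl)
open import Function.Bundles using (_↔_; Inverse)

record Graph (n : ℕ) : Set₁ where
  field
    E     : Fin n → Fin n → Set
    E?    : ∀ u v → Dec (E u v)
    sym   : ∀ {u v} → E u v → E v u
    irrefl : ∀ {u} → ¬ E u u
open Graph public

VSet : ℕ → Set₁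
VSet n = Fin n → Set

deg : ∀ {n} → Graph n → Fin n → ℕ
deg G v = length (filter (E? G v) (allFin _))

MinDegree : ∀ {n} → Graph n → ℕ → Set
MinDegree G d = (∀ v → d ≤ deg G v) × (∃ λ v → deg G v ≡ d)

Full : ∀ {n} → Graph n → Fin n → Set
Full G v = ∀ w → w ≢ v → E G v w

Dominating : ∀ {n} → Graph n → VSet n → Set
Dominating G D = ∀ x → D x ⊎ (∃ λ y → D y × E G y x)

Disjoint : ∀ {n} → VSet n → VSet n → Set
Disjoint A B = ∀ x → ¬ (A x × B x)

_∪_ : ∀ {n} → VSet n → VSet n → VSet n
(A ∪ B) x = A x ⊎ B x

Coalition : ∀ {n} → Graph n → VSet n → VSet n → Set
Coalition G A B =
  Disjoint A B × ¬ Dominating G A × ¬ Dominating G B × Dominating G (A ∪ B)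

❴_❵ : ∀ {n} → Fin n → VSet n
❴ v ❵ x = x ≡ v

-- Γ₁ (the singleton partition) is a coalition partition of G:
-- every member {v} is a dominating set of cardinality 1, or is not
-- dominating and forms a coalition with some other member {w}.
SPGraph : ∀ {n} → Graph n → Set
SPGraph G = ∀ v → Dominating G ❴ v ❵
               ⊎ (¬ Dominating G ❴ v ❵ × ∃ λ w → w ≢ v × Coalition G ❴ v ❵ ❴ w ❵)

dominating? : ∀ {n} (G : Graph n) (D : VSet n) → (∀ x → Dec (D x)) → Dec (Dominating G D)
dominating? G D D? = all? λ x → D? x ⊎-dec any? (λ y → D? y ×-dec E? G y x)

coalition? : ∀ {n} (G : Graph n) (A B : VSet n) → (∀ x → Dec (A x)) → (∀ x → Dec (B x))
           → Dec (Coalition G A B)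
coalition? G A B A? B? =
  all? (λ x → ¬? (A? x ×-dec B? x))
  ×-dec ¬? (dominating? G A A?)
  ×-dec ¬? (dominating? G B B?)
  ×-dec dominating? G (A ∪ B) (λ x → A? x ⊎-dec B? x)

-- The coalition graph CG(G, Γ₁): its vertex set Γ₁ is identified with
-- V(G) = Fin n via v ↦ {v}; {u},{v} adjacent iff they form a coalition.
CGE : ∀ {n} → Graph n → Fin n → Fin n → Set
CGE G u v = u ≢ v × Coalition G ❴ u ❵ ❴ v ❵

CG : ∀ {n} → Graph n → Graph n
CG G = record
  { E = CGE G
  ; E? = λ u v → ¬? (u ≟ v) ×-dec coalition? G ❴ u ❵ ❴ v ❵ (λ x → x ≟ u) (λ x → x ≟ v)
  ; sym = λ { (u≢v , disj , ¬du , ¬dv , d) →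
              (λ e → u≢v (symm e)) , (λ x (p , q) → disj x (q , p)) , ¬dv , ¬du ,
              (λ x → swap {G = G} (d x)) }
  ; irrefl = λ { (u≢u , _) → u≢u refl }
  }
  where
  symm : ∀ {A : Set} {a b : A} → a ≡ b → b ≡ a
  symm refl = refl
  swap : ∀ {n} {A B : VSet n} {G : Graph n} {x} →
         (A ∪ B) x ⊎ (∃ λ y → (A ∪ B) y × E G y x) →
         (B ∪ A) x ⊎ (∃ λ y → (B ∪ A) y × E G y x)
  swap (_⊎_.inj₁ (_⊎_.inj₁ a)) = _⊎_.inj₁ (_⊎_.inj₂ a)
  swap (_⊎_.inj₁ (_⊎_.inj₂ b)) = _⊎_.inj₁ (_⊎_.inj₁ b)
  swap (_⊎_.inj₂ (y , _⊎_.inj₁ a , e)) = _⊎_.inj₂ (y , _⊎_.inj₂ a , e)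
  swap (_⊎_.inj₂ (y , _⊎_.inj₂ b , e)) = _⊎_.inj₂ (y , _⊎_.inj₁ b , e)

Iso : ∀ {n} → Graph n → Graph n → Set
Iso {n} G H = Σ (Fin n ↔ Fin n) λ f →
  ∀ u v → (E G u v → E H (Inverse.to f u) (Inverse.to f v))
        × (E H (Inverse.to f u) (Inverse.to f v) → E G u v)

-- the singleton coalition graph chain: G₁ = G, G_{i+1} = CG(G_i, Γ₁)
-- (chainG i G is the graph G_{i+1})
chainG : ∀ {n} → ℕ → Graph n → Graph n
chainG zero G = G
chainG (suc i) G = CG (chainG i G)

-- G_{i+1} exists in the maximal chain iff G_1, …, G_i are SP-graphs
InChain : ∀ {n} → Graph n → ℕ → Set
InChain G i = ∀ j → j < i → SPGraph (chainG j G)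

AllIsomorphic : ∀ {n} → Graph n → Set
AllIsomorphic G = ∀ i → InChain G i → Iso (chainG i G) G

data Length : Set where
  fin : ℕ → Length
  ∞   : Length

LSCC : ∀ {n} → Graph n → Length → Set
LSCC G (fin m) =
  (AllIsomorphic G × m ≡ 0)
  ⊎ (¬ AllIsomorphic G × InChain G m × ¬ SPGraph (chainG m G))
LSCC G ∞ = ¬ AllIsomorphic G × (∀ i → SPGraph (chainG i G))

module Submission where

-- The full vertex v dominates G on its own, so it lies in no coalition and
-- is isolated in CG(G); as δ(G) = 2 has no isolated vertices, CG(G) ≇ G.
-- If CG(G) were an SP-graph, the isolated {v} would need a partner {w} with
-- {v, w} dominating CG(G), i.e. {w} forms a coalition with every other
-- singleton. Taking a neighbour z ≠ v of w, a vertex y undominated by w and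
-- a vertex q undominated by z, every vertex of G acquires three distinct
-- neighbours among v, w, y, z, q, contradicting δ(G) = 2.

open import Defs
open import Data.Nat using (ℕ; zero; suc; _≤_; z≤n; s≤s)
open import Data.Nat.Properties using (≤-trans; <-≤-trans; n≮n)
open import Data.Product using (∃; _×_; _,_; proj₁; proj₂)
open import Data.Sum using (inj₁; inj₂)
open import Data.Empty using (⊥-elim)
open import Data.Fin using (Fin; _≟_)
open import Data.Fin.Properties using (¬∀⟶∃¬)
open import Data.List using (List; []; _∷_; length; filter; allFin)
open import Data.List.Properties using (filter-notAll)
open import Data.List.Membership.Propositional using (_∈_)
open import Data.List.Membership.Propositional.Properties using (∈-filter⁺; ∈-filter⁻; ∈-allFin)
open import Data.List.Relation.Unary.Any using (here; there)
import Data.List.Relation.Unary.Any as Any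
open import Data.List.Relation.Unary.All as All using ([]; _∷_)
open import Data.List.Relation.Unary.AllPairs using ([]; _∷_)
open import Data.List.Relation.Unary.Unique.Propositional using (Unique)
open import Data.List.Relation.Unary.Unique.Propositional.Properties using (allFin⁺; filter⁺)
open import Relation.Nullary using (¬_; yes; no)
open import Relation.Nullary.Decidable using (_×-dec_; ¬?; decidable-stable)
open import Relation.Unary using (Pred; Decidable)
open import Relation.Binary.PropositionalEquality using (_≢_; refl; subst; ≢-sym)
  renaming (sym to ≡-sym)
open import Function.Bundles using (Inverse)

Unique-⊆⇒length≤ : ∀ {n} (xs ys : List (Fin n)) → Unique xs → (∀ {x} → x ∈ xs → x ∈ ys) →
                   length xs ≤ length ys
Unique-⊆⇒length≤ []       ys _          _  = z≤n
Unique-⊆⇒length≤ (x ∷ xs) ys (x∉ ∷ uxs) xs⊆ys =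
  <-≤-trans (s≤s (Unique-⊆⇒length≤ xs (filter ≢x? ys) uxs xs⊆ys-x))
            (filter-notAll ≢x? ys (Any.map (λ y≡x y≢x → y≢x (≡-sym y≡x)) (xs⊆ys (here refl))))
  where
  ≢x? = λ y → ¬? (y ≟ x)
  xs⊆ys-x : ∀ {z} → z ∈ xs → z ∈ filter ≢x? ys
  xs⊆ys-x z∈xs = ∈-filter⁺ ≢x? (xs⊆ys (there z∈xs)) (λ z≡x → All.lookup x∉ z∈xs (≡-sym z≡x))

¬∀¬⇒∃ : ∀ {n p} {P : Pred (Fin n) p} → Decidable P → ¬ (∀ x → ¬ P x) → ∃ P
¬∀¬⇒∃ {n} {P = P} P? ¬∀¬P with ¬∀⟶∃¬ n (λ x → ¬ P x) (λ x → ¬? (P? x)) ¬∀¬P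
... | x , ¬¬Px = x , decidable-stable (P? x) ¬¬Px

isolated⇒¬Iso : ∀ {n} (H G : Graph n) (v : Fin n) → (∀ x → ¬ E H v x) → (∀ x → ∃ (E G x)) →
                ¬ Iso H G
isolated⇒¬Iso H G v isolated hasNeighbour (f , f-iso)
  with c , e ← hasNeighbour (Inverse.to f v) =
  isolated (Inverse.from f c)
    (proj₂ (f-iso v (Inverse.from f c))
      (subst (E G (Inverse.to f v)) (≡-sym (Inverse.inverseˡ f refl)) e))

isolated⇒∃universalPartner : ∀ {n} (H : Graph n) → SPGraph H → ∀ {a b} → b ≢ a →
  (∀ x → ¬ E H a x) → ∃ λ w → w ≢ a × (∀ x → x ≢ a → x ≢ w → E H w x)
isolated⇒∃universalPartner H sp {a} {b} b≢a isolated with sp a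
... | inj₁ a-dominates with a-dominates b
...   | inj₁ b≡a           = ⊥-elim (b≢a b≡a)
...   | inj₂ (_ , refl , e) = ⊥-elim (isolated b e)
isolated⇒∃universalPartner H sp {a} b≢a isolated
  | inj₂ (_ , w , w≢a , (_ , _ , _ , aw-dominates)) = w , w≢a , adjacent
  where
  adjacent : ∀ x → x ≢ a → x ≢ w → E H w x
  adjacent x x≢a x≢w with aw-dominates x
  ... | inj₁ (inj₁ x≡a)          = ⊥-elim (x≢a x≡a)
  ... | inj₁ (inj₂ x≡w)          = ⊥-elim (x≢w x≡w)
  ... | inj₂ (_ , inj₁ refl , e) = ⊥-elim (isolated x e)
  ... | inj₂ (_ , inj₂ refl , e) = e

module _ {n : ℕ} (G : Graph n) where

  neighbours : Fin n → List (Fin n)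
  neighbours a = filter (E? G a) (allFin n)

  2≤deg⇒∃neighbour≢ : ∀ {a} → 2 ≤ deg G a → ∀ b → ∃ λ c → c ≢ b × E G a c
  2≤deg⇒∃neighbour≢ {a} 2≤deg b = ¬∀¬⇒∃ (λ c → ¬? (c ≟ b) ×-dec E? G a c) ¬∀¬
    where
    ¬∀¬ : ¬ (∀ c → ¬ (c ≢ b × E G a c))
    ¬∀¬ none with ≤-trans 2≤deg (Unique-⊆⇒length≤ (neighbours a) (b ∷ [])
                                 (filter⁺ (E? G a) (allFin⁺ n)) ⊆[b])
      where
      ⊆[b] : ∀ {x} → x ∈ neighbours a → x ∈ b ∷ []
      ⊆[b] {x} x∈ with x ≟ b
      ... | yes x≡b = here x≡b
      ... | no  x≢b = ⊥-elim (none x (x≢b , proj₂ (∈-filter⁻ (E? G a) {xs = allFin n} x∈)))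
    ... | s≤s ()

  three-neighbours⇒3≤deg : ∀ {u a b c} → a ≢ b → a ≢ c → b ≢ c →
                           E G u a → E G u b → E G u c → 3 ≤ deg G u
  three-neighbours⇒3≤deg {u} {a} {b} {c} a≢b a≢c b≢c ea eb ec =
    Unique-⊆⇒length≤ (a ∷ b ∷ c ∷ []) (neighbours u) ((a≢b ∷ a≢c ∷ []) ∷ (b≢c ∷ []) ∷ [] ∷ []) ⊆nbrs
    where
    ⊆nbrs : ∀ {x} → x ∈ a ∷ b ∷ c ∷ [] → x ∈ neighbours u
    ⊆nbrs (here refl)                 = ∈-filter⁺ (E? G u) (∈-allFin a) ea
    ⊆nbrs (there (here refl))         = ∈-filter⁺ (E? G u) (∈-allFin b) eb
    ⊆nbrs (there (there (here refl))) = ∈-filter⁺ (E? G u) (∈-allFin c) ec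

  ¬dominating⇒∃undominated : ∀ a → ¬ Dominating G ❴ a ❵ → ∃ λ y → y ≢ a × ¬ E G a y
  ¬dominating⇒∃undominated a ¬dom = ¬∀¬⇒∃ (λ y → ¬? (y ≟ a) ×-dec ¬? (E? G a y)) ¬∀¬
    where
    ¬∀¬ : ¬ (∀ y → ¬ (y ≢ a × ¬ E G a y))
    ¬∀¬ none = ¬dom dom
      where
      dom : Dominating G ❴ a ❵
      dom x with x ≟ a | E? G a x
      ... | yes x≡a | _      = inj₁ x≡a
      ... | no  _   | yes e  = inj₂ (a , refl , e)
      ... | no  x≢a | no  ¬e = ⊥-elim (none x (x≢a , ¬e))

  neighbour≢non-neighbour : ∀ {a b c} → E G a b → ¬ E G a c → b ≢ c
  neighbour≢non-neighbour e ¬e refl = ¬e e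

  full⇒dominating : ∀ {v} → Full G v → Dominating G ❴ v ❵
  full⇒dominating {v} full x with x ≟ v
  ... | yes x≡v = inj₁ x≡v
  ... | no  x≢v = inj₂ (v , refl , full x x≢v)

  full⇒isolated-in-CG : ∀ {v} → Full G v → ∀ x → ¬ E (CG G) v x
  full⇒isolated-in-CG full x (_ , _ , ¬v-dominates , _) = ¬v-dominates (full⇒dominating full)

  module UniversalCoalitionPartner
    (v : Fin n) (full : Full G v) (δ≥2 : ∀ x → 2 ≤ deg G x)
    (w : Fin n) (w≢v : w ≢ v) (partner : ∀ x → x ≢ v → x ≢ w → CGE G w x)
    where

    v~ : ∀ {x} → x ≢ v → E G x v
    v~ x≢v = Graph.sym G (full _ x≢v)

    -- Any x ∉ {v, w} forms a dominating pair with w, so it must dominate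
    -- whatever w misses.
    undominated-by-w⇒adjacent : ∀ {t} → t ≢ w → ¬ E G w t → ∀ {x} → x ≢ t → x ≢ w → E G x t
    undominated-by-w⇒adjacent {t} t≢w ¬w~t {x} x≢t x≢w with x ≟ v
    ... | yes refl = full t (λ { refl → ¬w~t (v~ w≢v) })
    ... | no  x≢v with proj₂ (proj₂ (proj₂ (proj₂ (partner x x≢v x≢w)))) t
    ...   | inj₁ (inj₁ t≡w)          = ⊥-elim (t≢w t≡w)
    ...   | inj₁ (inj₂ t≡x)          = ⊥-elim (x≢t (≡-sym t≡x))
    ...   | inj₂ (_ , inj₁ refl , e) = ⊥-elim (¬w~t e)
    ...   | inj₂ (_ , inj₂ refl , e) = e

    z-neighbour : ∃ λ z → z ≢ v × E G w z
    z-neighbour = 2≤deg⇒∃neighbour≢ (δ≥2 w) v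

    z : Fin n
    z = proj₁ z-neighbour

    z≢v : z ≢ v
    z≢v = proj₁ (proj₂ z-neighbour)

    w~z : E G w z
    w~z = proj₂ (proj₂ z-neighbour)

    z≢w : z ≢ w
    z≢w = neighbour≢non-neighbour w~z (irrefl G)

    wz-coalition : Coalition G ❴ w ❵ ❴ z ❵
    wz-coalition = proj₂ (partner z z≢v z≢w)

    y-undominated : ∃ λ y → y ≢ w × ¬ E G w y
    y-undominated = ¬dominating⇒∃undominated w (proj₁ (proj₂ wz-coalition))

    y : Fin n
    y = proj₁ y-undominated

    y≢w : y ≢ w
    y≢w = proj₁ (proj₂ y-undominated)

    ¬w~y : ¬ E G w y
    ¬w~y = proj₂ (proj₂ y-undominated)

    q-undominated : ∃ λ q → q ≢ z × ¬ E G z q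
    q-undominated = ¬dominating⇒∃undominated z (proj₁ (proj₂ (proj₂ wz-coalition)))

    q : Fin n
    q = proj₁ q-undominated

    q≢z : q ≢ z
    q≢z = proj₁ (proj₂ q-undominated)

    ¬z~q : ¬ E G z q
    ¬z~q = proj₂ (proj₂ q-undominated)

    y≢v : y ≢ v
    y≢v = ≢-sym (neighbour≢non-neighbour (v~ w≢v) ¬w~y)

    y≢z : y ≢ z
    y≢z = ≢-sym (neighbour≢non-neighbour w~z ¬w~y)

    q≢v : q ≢ v
    q≢v = ≢-sym (neighbour≢non-neighbour (v~ z≢v) ¬z~q)

    q≢w : q ≢ w
    q≢w = ≢-sym (neighbour≢non-neighbour (Graph.sym G w~z) ¬z~q)

    w~q : E G w q
    w~q with E? G w q
    ... | yes w~q = w~q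
    ... | no ¬w~q = ⊥-elim (¬z~q (undominated-by-w⇒adjacent q≢w ¬w~q (≢-sym q≢z) z≢w))

    every-3≤deg : ∀ u → 3 ≤ deg G u
    every-3≤deg u with u ≟ v | u ≟ w | E? G w u
    ... | yes refl | _ | _ =
      three-neighbours⇒3≤deg (≢-sym y≢w) (≢-sym z≢w) y≢z (full w w≢v) (full y y≢v) (full z z≢v)
    ... | no u≢v | yes refl | _ =
      three-neighbours⇒3≤deg (≢-sym z≢v) (≢-sym q≢v) (≢-sym q≢z) (v~ w≢v) w~z w~q
    ... | no u≢v | no u≢w | yes w~u =
      three-neighbours⇒3≤deg w≢v (≢-sym y≢w) (≢-sym y≢v) (Graph.sym G w~u) (v~ u≢v)
        (undominated-by-w⇒adjacent y≢w ¬w~y (neighbour≢non-neighbour w~u ¬w~y) u≢w)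
    ... | no u≢v | no u≢w | no ¬w~u =
      three-neighbours⇒3≤deg (≢-sym q≢z) z≢v q≢v
        (Graph.sym G (undominated-by-w⇒adjacent u≢w ¬w~u (neighbour≢non-neighbour w~z ¬w~u) z≢w))
        (Graph.sym G (undominated-by-w⇒adjacent u≢w ¬w~u (neighbour≢non-neighbour w~q ¬w~u) q≢w))
        (v~ u≢v)

theorem11 : ∀ (n : ℕ) (G : Graph n) → SPGraph G → MinDegree G 2 → ∃ (λ v → Full G v)
            → LSCC G (fin 1)
theorem11 n G sp (δ≥2 , u , deg-u≡2) (v , full) =
  inj₂ ((λ all-iso → CG≇G (all-iso 1 sp-up-to-1)) , sp-up-to-1 , CG-¬SP)
  where
  isolated : ∀ x → ¬ E (CG G) v x
  isolated = full⇒isolated-in-CG G full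

  CG≇G : ¬ Iso (CG G) G
  CG≇G = isolated⇒¬Iso (CG G) G v isolated
           (λ x → let (c , _ , e) = 2≤deg⇒∃neighbour≢ G (δ≥2 x) x in c , e)

  sp-up-to-1 : InChain G 1
  sp-up-to-1 zero    _        = sp
  sp-up-to-1 (suc j) (s≤s ())

  CG-¬SP : ¬ SPGraph (CG G)
  CG-¬SP sp-CG
    with c , c≢v , _   ← 2≤deg⇒∃neighbour≢ G (δ≥2 v) v
    with w , w≢v , partner ← isolated⇒∃universalPartner (CG G) sp-CG c≢v isolated
    = n≮n 2 (subst (3 ≤_) deg-u≡2
                (UniversalCoalitionPartner.every-3≤deg G v full δ≥2 w w≢v partner u))
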